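{- Let $R_{n,k}$ be as defined in the context and $\mathcal{R}(x,y)=\sum_{n,k\ge0}\frac{R_{n,k}}{n!}x^ny^k$. Then \[\mathcal{R}(x,y)-2(y-1)y\frac{\partial\mathcal{R}(x,y)}{\partial y}+(xy-1)\frac{\partial\mathcal{R}(x,y)}{\partial x}=0.\]
   Context: For $n\ge1$, $S_n$ is the set of permutations of $\{0,\dots,n-1\}$ in one-line notation. A 3-dimensional permutation of length $n$ is a pair $\Pi=(\pi^2,\pi^3)$ of elements of $S_n$ (for $n=0$, the single empty permutation); its elements are the columns $\Pi_j=(\pi^2_j,\pi^3_j)^T$, and the level of $\Pi_j$ is $\max\{\pi^2_j,\pi^3_j\}$. $\Pi$ is canonical if $\pi^2=01\cdots(n-1)$. $R_{n,k}$ is the number of canonical 3-dimensional permutations of length $n$ in which exactly $k$ distinct level values are each attained by two elements (with $R_{0,0}=1$, $R_{0,k}=0$ for $k\ge1$). -}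

module Defs where

open import Data.Nat using (ℕ; zero; suc; _⊔_; _!; _≟_)
open import Data.Nat.Properties using (_!≢0)
open import Data.List using (List; []; _∷_; length; filter; upTo; zip; map; concatMap)
open import Data.Product using (_,_; _×_)
open import Data.Integer using (+_)
open import Data.Rational using (ℚ; 0ℚ; 1ℚ; _/_; _+_; _-_; _*_)
open import Data.List.Relation.Unary.Unique.DecPropositional _≟_ using (unique?)

-- Permutations of {0,…,n-1} in one-line notation, as lists of length n.

seqs : ℕ → ℕ → List (List ℕ)
seqs zero    n = [] ∷ []
seqs (suc m) n = concatMap (λ a → map (a ∷_) (seqs m n)) (upTo n)

perms : ℕ → List (List ℕ)
perms n = filter unique? (seqs n n)

-- A canonical 3-dimensional permutation of length n is (01⋯(n-1), σ),
-- determined by σ ∈ S_n.  Its columns are (j, σ j); level = max.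

levels : List ℕ → List ℕ
levels σ = map (λ c → Data.Product.proj₁ c ⊔ Data.Product.proj₂ c) (zip (upTo (length σ)) σ)

mult : List ℕ → ℕ → ℕ
mult σ v = length (filter (λ l → l ≟ v) (levels σ))

doubleLevels : List ℕ → ℕ
doubleLevels σ = length (filter (λ v → mult σ v ≟ 2) (upTo (length σ)))

R : ℕ → ℕ → ℕ
R n k = length (filter (λ σ → doubleLevels σ ≟ k) (perms n))

-- Formal power series in x, y over ℚ:  F n k = coefficient of x^n y^k.

FPS : Set
FPS = ℕ → ℕ → ℚ

ℕ→ℚ : ℕ → ℚ
ℕ→ℚ m = (+ m) / 1

𝓡 : FPS
𝓡 n k = _/_ (+ R n k) (n !) {{n !≢0}}

_⊕_ : FPS → FPS → FPS
(F ⊕ G) n k = F n k + G n k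

_⊖_ : FPS → FPS → FPS
(F ⊖ G) n k = F n k - G n k

_·_ : ℚ → FPS → FPS
(c · F) n k = c * F n k

mulX : FPS → FPS
mulX F zero    k = 0ℚ
mulX F (suc n) k = F n k

mulY : FPS → FPS
mulY F n zero    = 0ℚ
mulY F n (suc k) = F n k

∂x : FPS → FPS
∂x F n k = ℕ→ℚ (suc n) * F (suc n) k

∂y : FPS → FPS
∂y F n k = ℕ→ℚ (suc k) * F n (suc k)

𝟘 : FPS
𝟘 n k = 0ℚ

-- Every σ ∈ S_{n+1} arises from exactly one τ ∈ S_n and j ≤ n by writing n into column j of τ
-- and moving τ_j to a new last column (for j = n: appending n). For j < n both of these columns
-- have level n, so n becomes a double level, while the level ℓ_j = max(j, τ_j) of the old column
-- loses an element. If τ has D double levels, σ therefore has D of them when ℓ_j is a double level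
-- of τ (2D choices of j) or j = n, and D + 1 otherwise (n - 2D choices). Summing over τ gives
-- R_{n+1,0} = R_{n,0} and R_{n+1,k+1} + 2k R_{n,k} = (2k+3) R_{n,k+1} + n R_{n,k}, which is
-- exactly the vanishing of the coefficient of x^n y^k once R_{n,k}/n! is substituted.

module Submission where

open import Defs
open import Data.Nat using (ℕ; zero; suc; _+_; _*_; _≤_; _<_; z≤n; s≤s; _⊔_; _≟_; _!; NonZero)
open import Data.Nat.ListAction using (sum)
open import Data.Nat.ListAction.Properties using (sum-++; sum-↭)
open import Data.Nat.Properties
open import Data.Nat.Tactic.RingSolver using (solve-∀)
open import Algebra.Properties.CommutativeSemigroup +-commutativeSemigroup using (interchange)
open import Data.Empty using (⊥-elim)
import Data.Integer as ℤ
import Data.Integer.Properties as ℤP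
open import Data.Integer.Tactic.RingSolver using () renaming (solve-∀ to ℤ-solve-∀)
open import Data.List
  using (List; []; _∷_; _++_; _∷ʳ_; length; map; filter; zip; upTo; applyUpTo; concatMap;
         cartesianProductWith; initLast; _∷ʳ′_)
open import Data.List.Membership.DecPropositional _≟_ using (_∈?_)
open import Data.List.Membership.Propositional using (_∈_; _∉_)
open import Data.List.Membership.Propositional.Properties
open import Data.List.Membership.Propositional.Properties.WithK using (unique∧set⇒bag)
open import Data.List.Properties
  using (map-++; map-∘; map-upTo; length-upTo; length-++; upTo-∷ʳ; ∷-injective; ∷ʳ-injective)
open import Data.List.Relation.Binary.BagAndSetEquality using (∼bag⇒↭)
open import Data.List.Relation.Binary.Permutation.Propositional using (_↭_)
import Data.List.Relation.Binary.Permutation.Propositional.Properties as ↭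
open import Data.List.Relation.Unary.All as All using (All; []; _∷_)
import Data.List.Relation.Unary.All.Properties as AllP
open import Data.List.Relation.Unary.AllPairs using ([]; _∷_)
open import Data.List.Relation.Unary.Any using (here; there)
open import Data.List.Relation.Unary.Unique.DecPropositional _≟_ using (unique?)
open import Data.List.Relation.Unary.Unique.Propositional using (Unique)
import Data.List.Relation.Unary.Unique.Propositional.Properties as Unique
open import Data.Product using (_×_; _,_; proj₁; proj₂; ∃₂)
open import Data.Rational as ℚ using (ℚ; _/_; 0ℚ; 1ℚ)
import Data.Rational.Properties as ℚP
open import Data.Rational.Solver using (module +-*-Solver)
open import Data.Rational.Unnormalised as ℚᵘ using (mkℚᵘ; *≡*)
import Data.Rational.Unnormalised.Properties as ℚᵘP
open import Data.Sum using (_⊎_; inj₁; inj₂)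
open import Function using (_∘_; id; mk⇔)
open import Relation.Binary.PropositionalEquality
open import Relation.Nullary using (Dec; yes; no; ¬_)
open import Relation.Unary using (Decidable)

open +-*-Solver using (solve; _:+_; _:-_; _:*_; con; _:=_)

private
  variable
    A B C : Set

χ : {P : Set} → Dec P → ℕ
χ (yes _) = 1
χ (no _)  = 0

χ≤1 : {P : Set} (d : Dec P) → χ d ≤ 1
χ≤1 (yes _) = s≤s z≤n
χ≤1 (no _)  = z≤n

∑ : List A → (A → ℕ) → ℕ
∑ xs f = sum (map f xs)

length-filter≡∑χ : {P : A → Set} (P? : Decidable P) (xs : List A) →
                   length (filter P? xs) ≡ ∑ xs (χ ∘ P?)
length-filter≡∑χ P? []       = refl
length-filter≡∑χ P? (x ∷ xs) with P? x
... | yes _ = cong suc (length-filter≡∑χ P? xs)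
... | no _  = length-filter≡∑χ P? xs

∑-++ : ∀ (xs ys : List A) f → ∑ (xs ++ ys) f ≡ ∑ xs f + ∑ ys f
∑-++ xs ys f = trans (cong sum (map-++ f xs ys)) (sum-++ (map f xs) (map f ys))

∑-map : (g : A → B) (xs : List A) (f : B → ℕ) → ∑ (map g xs) f ≡ ∑ xs (f ∘ g)
∑-map g xs f = cong sum (sym (map-∘ xs))

∑-cong : ∀ (xs : List A) {f g} → (∀ {x} → x ∈ xs → f x ≡ g x) → ∑ xs f ≡ ∑ xs g
∑-cong []       eq = refl
∑-cong (x ∷ xs) eq = cong₂ _+_ (eq (here refl)) (∑-cong xs (eq ∘ there))

∑-mono-≤ : ∀ (xs : List A) {f g} → (∀ {x} → x ∈ xs → f x ≤ g x) → ∑ xs f ≤ ∑ xs g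
∑-mono-≤ []       le = z≤n
∑-mono-≤ (x ∷ xs) le = +-mono-≤ (le (here refl)) (∑-mono-≤ xs (le ∘ there))

∑-+ : ∀ (xs : List A) f g → ∑ xs (λ x → f x + g x) ≡ ∑ xs f + ∑ xs g
∑-+ []       f g = refl
∑-+ (x ∷ xs) f g =
  trans (cong (f x + g x +_) (∑-+ xs f g)) (interchange (f x) (g x) (∑ xs f) (∑ xs g))

∑-*ˡ : ∀ (xs : List A) k f → ∑ xs (λ x → k * f x) ≡ k * ∑ xs f
∑-*ˡ []       k f = sym (*-zeroʳ k)
∑-*ˡ (x ∷ xs) k f =
  trans (cong (k * f x +_) (∑-*ˡ xs k f)) (sym (*-distribˡ-+ k (f x) (∑ xs f)))

∑-const : ∀ (xs : List A) k → ∑ xs (λ _ → k) ≡ length xs * k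
∑-const []       k = refl
∑-const (x ∷ xs) k = cong (k +_) (∑-const xs k)

∑-cartesianProductWith : (g : A → B → C) (xs : List A) (ys : List B) (f : C → ℕ) →
  ∑ (cartesianProductWith g xs ys) f ≡ ∑ xs (λ x → ∑ ys (λ y → f (g x y)))
∑-cartesianProductWith g []       ys f = refl
∑-cartesianProductWith g (x ∷ xs) ys f = begin
  ∑ (map (g x) ys ++ cartesianProductWith g xs ys) f
    ≡⟨ ∑-++ (map (g x) ys) _ f ⟩
  ∑ (map (g x) ys) f + ∑ (cartesianProductWith g xs ys) f
    ≡⟨ cong₂ _+_ (∑-map (g x) ys f) (∑-cartesianProductWith g xs ys f) ⟩
  ∑ ys (λ y → f (g x y)) + ∑ xs (λ x → ∑ ys (λ y → f (g x y))) ∎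
  where open ≡-Reasoning

∑-upTo-suc : ∀ n f → ∑ (upTo (suc n)) f ≡ ∑ (upTo n) f + f n
∑-upTo-suc n f = begin
  ∑ (upTo (suc n)) f         ≡⟨ cong (λ xs → ∑ xs f) (sym (upTo-∷ʳ n)) ⟩
  ∑ (upTo n ∷ʳ n) f          ≡⟨ ∑-++ (upTo n) (n ∷ []) f ⟩
  ∑ (upTo n) f + (f n + 0)   ≡⟨ cong (∑ (upTo n) f +_) (+-identityʳ (f n)) ⟩
  ∑ (upTo n) f + f n         ∎
  where open ≡-Reasoning

occ : ℕ → List ℕ → ℕ
occ v xs = ∑ xs (λ x → χ (x ≟ v))

occ-∉ : ∀ {v} xs → v ∉ xs → occ v xs ≡ 0
occ-∉     []       _  = refl
occ-∉ {v} (x ∷ xs) v∉ with x ≟ v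
... | yes refl = ⊥-elim (v∉ (here refl))
... | no _     = occ-∉ xs (v∉ ∘ there)

occ-unique≤1 : ∀ {v xs} → Unique xs → occ v xs ≤ 1
occ-unique≤1 {v} {[]}     _ = z≤n
occ-unique≤1 {v} {x ∷ xs} u@(_ ∷ u′) with x ≟ v
... | yes refl = s≤s (≤-reflexive (occ-∉ xs (Unique.Unique[x∷xs]⇒x∉xs u)))
... | no _     = occ-unique≤1 u′

∑-δ-∉ : ∀ {x} (ys : List ℕ) (f : ℕ → ℕ) → x ∉ ys →
        ∑ ys (λ v → χ (x ≟ v) * f v) ≡ 0
∑-δ-∉     []       f _  = refl
∑-δ-∉ {x} (y ∷ ys) f x∉ with x ≟ y
... | yes refl = ⊥-elim (x∉ (here refl))
... | no _     = ∑-δ-∉ ys f (x∉ ∘ there)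

∑-δ : ∀ {x} {ys : List ℕ} (f : ℕ → ℕ) → Unique ys → x ∈ ys →
      ∑ ys (λ v → χ (x ≟ v) * f v) ≡ f x
∑-δ {x} {y ∷ ys} f u x∈ with x ≟ y | x∈
... | yes refl | _        =
  trans (cong₂ _+_ (+-identityʳ (f x)) (∑-δ-∉ ys f x∉ys)) (+-identityʳ (f x))
  where x∉ys = Unique.Unique[x∷xs]⇒x∉xs u
... | no x≢y   | here x≡y = ⊥-elim (x≢y x≡y)
... | no _     | there x∈′ with _ ∷ u′ ← u = ∑-δ f u′ x∈′

∑-by-occ : ∀ m (f : ℕ → ℕ) xs → All (_< m) xs →
           ∑ xs f ≡ ∑ (upTo m) (λ v → occ v xs * f v)
∑-by-occ m f []       [] = sym (trans (∑-const (upTo m) 0) (*-zeroʳ (length (upTo m))))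
∑-by-occ m f (x ∷ xs) (x<m ∷ xs<m) = begin
  f x + ∑ xs f
    ≡⟨ cong₂ _+_ (sym (∑-δ f (Unique.upTo⁺ m) (∈-upTo⁺ x<m))) (∑-by-occ m f xs xs<m) ⟩
  ∑ (upTo m) (λ v → χ (x ≟ v) * f v) + ∑ (upTo m) (λ v → occ v xs * f v)
    ≡⟨ sym (∑-+ (upTo m) _ _) ⟩
  ∑ (upTo m) (λ v → χ (x ≟ v) * f v + occ v xs * f v)
    ≡⟨ ∑-cong (upTo m) (λ {v} _ → sym (*-distribʳ-+ (f v) (χ (x ≟ v)) (occ v xs))) ⟩
  ∑ (upTo m) (λ v → occ v (x ∷ xs) * f v) ∎
  where open ≡-Reasoning

unique-bounded⇒length≤ : ∀ {m xs} → Unique xs → All (_< m) xs → length xs ≤ m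
unique-bounded⇒length≤ {m} {xs} u xs<m = begin
  length xs                        ≡⟨ sym (*-identityʳ (length xs)) ⟩
  length xs * 1                    ≡⟨ sym (∑-const xs 1) ⟩
  ∑ xs (λ _ → 1)                   ≡⟨ ∑-by-occ m _ xs xs<m ⟩
  ∑ (upTo m) (λ v → occ v xs * 1)  ≤⟨ ∑-mono-≤ (upTo m) (λ {v} _ → occ*1≤1 v) ⟩
  ∑ (upTo m) (λ _ → 1)             ≡⟨ ∑-const (upTo m) 1 ⟩
  length (upTo m) * 1              ≡⟨ trans (*-identityʳ _) (length-upTo m) ⟩
  m                                ∎
  where
  open ≤-Reasoning
  occ*1≤1 : ∀ v → occ v xs * 1 ≤ 1
  occ*1≤1 v = subst (_≤ 1) (sym (*-identityʳ (occ v xs))) (occ-unique≤1 u)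

-- Positions j ≥ length xs are allowed: there setAt changes nothing and getAt returns the default.
setAt : List A → ℕ → A → List A
setAt []       j       y = []
setAt (x ∷ xs) zero    y = y ∷ xs
setAt (x ∷ xs) (suc j) y = x ∷ setAt xs j y

getAt : List A → ℕ → A → A
getAt []       j       d = d
getAt (x ∷ xs) zero    d = x
getAt (x ∷ xs) (suc j) d = getAt xs j d

indexOf : ℕ → List ℕ → ℕ
indexOf y []       = 0
indexOf y (x ∷ xs) with x ≟ y
... | yes _ = 0
... | no _  = suc (indexOf y xs)

length-setAt : ∀ (xs : List A) j y → length (setAt xs j y) ≡ length xs
length-setAt []       j       y = refl
length-setAt (x ∷ xs) zero    y = refl
length-setAt (x ∷ xs) (suc j) y = cong suc (length-setAt xs j y)

setAt-getAt : ∀ (xs : List A) j d → setAt xs j (getAt xs j d) ≡ xs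
setAt-getAt []       j       d = refl
setAt-getAt (x ∷ xs) zero    d = refl
setAt-getAt (x ∷ xs) (suc j) d = cong (x ∷_) (setAt-getAt xs j d)

setAt-setAt : ∀ (xs : List A) j y z → setAt (setAt xs j y) j z ≡ setAt xs j z
setAt-setAt []       j       y z = refl
setAt-setAt (x ∷ xs) zero    y z = refl
setAt-setAt (x ∷ xs) (suc j) y z = cong (x ∷_) (setAt-setAt xs j y z)

getAt-setAt : ∀ (xs : List A) j y d → j < length xs → getAt (setAt xs j y) j d ≡ y
getAt-setAt (x ∷ xs) zero    y d _         = refl
getAt-setAt (x ∷ xs) (suc j) y d (s≤s j<) = getAt-setAt xs j y d j<

setAt-≥ : ∀ (xs : List A) j y → length xs ≤ j → setAt xs j y ≡ xs
setAt-≥ []       j       y _         = refl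
setAt-≥ (x ∷ xs) (suc j) y (s≤s ≤j) = cong (x ∷_) (setAt-≥ xs j y ≤j)

getAt-≥ : ∀ (xs : List A) j d → length xs ≤ j → getAt xs j d ≡ d
getAt-≥ []       j       d _         = refl
getAt-≥ (x ∷ xs) (suc j) d (s≤s ≤j) = getAt-≥ xs j d ≤j

getAt-∈ : ∀ (xs : List A) j d → j < length xs → getAt xs j d ∈ xs
getAt-∈ (x ∷ xs) zero    d _         = here refl
getAt-∈ (x ∷ xs) (suc j) d (s≤s j<) = there (getAt-∈ xs j d j<)

All-getAt : ∀ {P : A → Set} {xs} j {d} → All P xs → P d → P (getAt xs j d)
All-getAt j       []         Pd = Pd
All-getAt zero    (Px ∷ _)   _  = Px
All-getAt (suc j) (_ ∷ Pxs) Pd = All-getAt j Pxs Pd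

All-setAt : ∀ {P : A → Set} {xs} j {y} → All P xs → P y → All P (setAt xs j y)
All-setAt j       []          Py = []
All-setAt zero    (_ ∷ Pxs)  Py = Py ∷ Pxs
All-setAt (suc j) (Px ∷ Pxs) Py = Px ∷ All-setAt j Pxs Py

map-getAt-upTo : ∀ (xs : List A) d → map (λ j → getAt xs j d) (upTo (length xs)) ≡ xs
map-getAt-upTo xs d = trans (map-upTo _ (length xs)) (go xs)
  where
  go : ∀ xs → applyUpTo (λ j → getAt xs j d) (length xs) ≡ xs
  go []       = refl
  go (x ∷ xs) = cong (x ∷_) (go xs)

∈-setAt⁻ : ∀ {z} (xs : List A) j y → z ∈ setAt xs j y → z ≡ y ⊎ z ∈ xs
∈-setAt⁻ (x ∷ xs) zero    y (here refl) = inj₁ refl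
∈-setAt⁻ (x ∷ xs) zero    y (there z∈)  = inj₂ (there z∈)
∈-setAt⁻ (x ∷ xs) (suc j) y (here refl) = inj₂ (here refl)
∈-setAt⁻ (x ∷ xs) (suc j) y (there z∈)  with ∈-setAt⁻ xs j y z∈
... | inj₁ z≡y  = inj₁ z≡y
... | inj₂ z∈xs = inj₂ (there z∈xs)

setAt-unique : ∀ {xs : List A} j {y} → Unique xs → y ∉ xs → Unique (setAt xs j y)
setAt-unique {xs = []}     j       _          _  = []
setAt-unique {xs = x ∷ xs} zero    (_ ∷ u)    y∉ =
  All.tabulate (λ { z∈ refl → y∉ (there z∈) }) ∷ u
setAt-unique {xs = x ∷ xs} (suc j) (x∉ ∷ u) y∉ =
  All.tabulate x∉setAt ∷ setAt-unique j u (y∉ ∘ there)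
  where
  x∉setAt : ∀ {z} → z ∈ setAt xs j _ → x ≢ z
  x∉setAt z∈ refl with ∈-setAt⁻ xs j _ z∈
  ... | inj₁ refl = y∉ (here refl)
  ... | inj₂ x∈xs = All.lookup x∉ x∈xs refl

getAt-∉-setAt : ∀ {xs : List A} j {y d} → Unique xs → j < length xs → y ≢ getAt xs j d →
                getAt xs j d ∉ setAt xs j y
getAt-∉-setAt {xs = x ∷ xs} zero    _        _        y≢ (here x≡y) = y≢ (sym x≡y)
getAt-∉-setAt {xs = x ∷ xs} zero    (x∉ ∷ _) _        _  (there x∈) = All.lookup x∉ x∈ refl
getAt-∉-setAt {xs = x ∷ xs} (suc j) (x∉ ∷ _) (s≤s j<) _  (here eq)  =
  All.lookup x∉ (getAt-∈ xs j _ j<) (sym eq)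
getAt-∉-setAt {xs = x ∷ xs} (suc j) (_ ∷ u)  (s≤s j<) y≢ (there z∈) = getAt-∉-setAt j u j< y≢ z∈

getAt-indexOf : ∀ y xs → getAt xs (indexOf y xs) y ≡ y
getAt-indexOf y []       = refl
getAt-indexOf y (x ∷ xs) with x ≟ y
... | yes x≡y = x≡y
... | no _    = getAt-indexOf y xs

indexOf-< : ∀ {y xs} → y ∈ xs → indexOf y xs < length xs
indexOf-< {y} {x ∷ xs} y∈ with x ≟ y | y∈
... | yes _  | _          = s≤s z≤n
... | no x≢y | here y≡x   = ⊥-elim (x≢y (sym y≡x))
... | no _   | there y∈xs = s≤s (indexOf-< y∈xs)

indexOf-setAt : ∀ {y} xs j → y ∉ xs → j ≤ length xs → indexOf y (setAt xs j y) ≡ j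
indexOf-setAt {y} []       zero    _  _ = refl
indexOf-setAt {y} (x ∷ xs) zero    _  _ with y ≟ y
... | yes _   = refl
... | no y≢y  = ⊥-elim (y≢y refl)
indexOf-setAt {y} (x ∷ xs) (suc j) y∉ (s≤s j≤) with x ≟ y
... | yes refl = ⊥-elim (y∉ (here refl))
... | no _     = cong suc (indexOf-setAt xs j (y∉ ∘ there) j≤)

occ-setAt : ∀ v xs j y → occ v (setAt xs j y) + χ (getAt xs j y ≟ v) ≡ occ v xs + χ (y ≟ v)
occ-setAt v []       j       y = refl
occ-setAt v (x ∷ xs) zero    y = exchange (χ (y ≟ v)) (occ v xs) (χ (x ≟ v))
  where
  exchange : ∀ a b c → a + b + c ≡ c + b + a
  exchange = solve-∀
occ-setAt v (x ∷ xs) (suc j) y = trans (+-assoc (χ (x ≟ v)) _ _)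
  (trans (cong (χ (x ≟ v) +_) (occ-setAt v xs j y)) (sym (+-assoc (χ (x ≟ v)) _ _)))

-- Enumeration of S_n

record IsPerm (n : ℕ) (σ : List ℕ) : Set where
  field
    length≡ : length σ ≡ n
    bounded : All (_< n) σ
    unique  : Unique σ

concatMap-map≡cartesianProductWith : ∀ (f : A → B → C) xs ys →
  concatMap (λ x → map (f x) ys) xs ≡ cartesianProductWith f xs ys
concatMap-map≡cartesianProductWith f []       ys = refl
concatMap-map≡cartesianProductWith f (x ∷ xs) ys =
  cong (map (f x) ys ++_) (concatMap-map≡cartesianProductWith f xs ys)

seqs-suc : ∀ m n → seqs (suc m) n ≡ cartesianProductWith _∷_ (upTo n) (seqs m n)
seqs-suc m n = concatMap-map≡cartesianProductWith _∷_ (upTo n) (seqs m n)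

∈-seqs⁺ : ∀ {xs} m n → length xs ≡ m → All (_< n) xs → xs ∈ seqs m n
∈-seqs⁺ {[]}     zero    n _   []            = here refl
∈-seqs⁺ {x ∷ xs} (suc m) n len (x<n ∷ xs<n) = subst (x ∷ xs ∈_) (sym (seqs-suc m n))
  (∈-cartesianProductWith⁺ _∷_ (∈-upTo⁺ x<n) (∈-seqs⁺ m n (suc-injective len) xs<n))

∈-seqs⁻ : ∀ {xs} m n → xs ∈ seqs m n → length xs ≡ m × All (_< n) xs
∈-seqs⁻ zero    n (here refl) = refl , []
∈-seqs⁻ (suc m) n xs∈
  with _ , _ , x∈ , ys∈ , refl ←
       ∈-cartesianProductWith⁻ _∷_ (upTo n) (seqs m n) (subst (_ ∈_) (seqs-suc m n) xs∈)
  with len , ys<n ← ∈-seqs⁻ m n ys∈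
  = cong suc len , ∈-upTo⁻ x∈ ∷ ys<n

seqs-unique : ∀ m n → Unique (seqs m n)
seqs-unique zero    n = [] ∷ []
seqs-unique (suc m) n = subst Unique (sym (seqs-suc m n))
  (Unique.cartesianProductWith⁺ _∷_ ∷-injective (Unique.upTo⁺ n) (seqs-unique m n))

perms-unique : ∀ n → Unique (perms n)
perms-unique n = Unique.filter⁺ unique? (seqs-unique n n)

∈-perms⁺ : ∀ {n σ} → IsPerm n σ → σ ∈ perms n
∈-perms⁺ {n} p = ∈-filter⁺ unique? (∈-seqs⁺ n n length≡ bounded) unique
  where open IsPerm p

∈-perms⁻ : ∀ {n σ} → σ ∈ perms n → IsPerm n σ
∈-perms⁻ {n} σ∈ with σ∈seqs , u ← ∈-filter⁻ unique? σ∈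
                 with len , σ<n ← ∈-seqs⁻ n n σ∈seqs
  = record { length≡ = len ; bounded = σ<n ; unique = u }

∷ʳ-unique : ∀ {xs : List A} {x} → Unique xs → x ∉ xs → Unique (xs ∷ʳ x)
∷ʳ-unique u x∉ = Unique.++⁺ u ([] ∷ []) (λ { (x∈ , here refl) → x∉ x∈ })

∷ʳ-unique⁻ : ∀ (xs : List A) {x} → Unique (xs ∷ʳ x) → Unique xs × x ∉ xs
∷ʳ-unique⁻ []       _          = [] , λ ()
∷ʳ-unique⁻ (y ∷ xs) (y∉ ∷ u) with u′ , x∉ ← ∷ʳ-unique⁻ xs u =
  AllP.++⁻ˡ xs y∉ ∷ u′ , λ { (here refl) → All.lookup y∉ (∈-++⁺ʳ xs (here refl)) refl
                           ; (there x∈) → x∉ x∈ }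

map-unique : ∀ (f : A → B) {xs} → (∀ {x y} → x ∈ xs → y ∈ xs → f x ≡ f y → x ≡ y) →
             Unique xs → Unique (map f xs)
map-unique f {[]}     inj _          = []
map-unique f {x ∷ xs} inj (x∉ ∷ u) =
  All.tabulate fx∉ ∷ map-unique f (λ x∈ y∈ → inj (there x∈) (there y∈)) u
  where
  fx∉ : ∀ {z} → z ∈ map f xs → f x ≢ z
  fx∉ z∈ fx≡z with y , y∈ , refl ← ∈-map⁻ f z∈ =
    All.lookup x∉ y∈ (inj (here refl) (there y∈) fx≡z)

cartesianProductWith-unique : ∀ (f : A → B → C) {xs ys} →
  (∀ {w x y z} → w ∈ xs → x ∈ xs → y ∈ ys → z ∈ ys →
                  f w y ≡ f x z → w ≡ x × y ≡ z) →
  Unique xs → Unique ys → Unique (cartesianProductWith f xs ys)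
cartesianProductWith-unique f {[]}     inj _          _  = []
cartesianProductWith-unique f {x ∷ xs} {ys} inj (x∉ ∷ u) uys =
  Unique.++⁺ (map-unique (f x) (λ y∈ z∈ eq → proj₂ (inj (here refl) (here refl) y∈ z∈ eq)) uys)
             (cartesianProductWith-unique f (λ w∈ x∈ → inj (there w∈) (there x∈)) u uys)
             disjoint
  where
  disjoint : ∀ {v} → ¬ (v ∈ map (f x) ys × v ∈ cartesianProductWith f xs ys)
  disjoint (v∈ , v∈′) with y , y∈ , refl ← ∈-map⁻ (f x) v∈
                      with w , z , w∈ , z∈ , eq ← ∈-cartesianProductWith⁻ f xs ys v∈′
    = All.lookup x∉ w∈ (proj₁ (inj (here refl) (there w∈) y∈ z∈ eq))

-- Inserting the maximum

-- n is written into column j of τ and τ_j moves to a new last column; j = n is out of range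
-- and appends n.
insertMax : ℕ → List ℕ → ℕ → List ℕ
insertMax n τ j = setAt τ j n ∷ʳ getAt τ j n

length-∷ʳ : ∀ (xs : List A) x → length (xs ∷ʳ x) ≡ suc (length xs)
length-∷ʳ xs x = trans (length-++ xs) (+-comm (length xs) 1)

module _ {n τ} (τ-perm : IsPerm n τ) where
  open IsPerm τ-perm

  n∉τ : n ∉ τ
  n∉τ n∈ = n≮n n (All.lookup bounded n∈)

  insertMax-last : insertMax n τ n ≡ τ ∷ʳ n
  insertMax-last = cong₂ _∷ʳ_ (setAt-≥ τ n n len≤n) (getAt-≥ τ n n len≤n)
    where len≤n = ≤-reflexive length≡

  IsPerm-insertMax : ∀ {j} → j ≤ n → IsPerm (suc n) (insertMax n τ j)
  IsPerm-insertMax {j} j≤n = record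
    { length≡ = trans (length-∷ʳ (setAt τ j n) _) (cong suc (trans (length-setAt τ j n) length≡))
    ; bounded = AllP.++⁺ (All-setAt j τ<1+n (n<1+n n)) (All-getAt j τ<1+n (n<1+n n) ∷ [])
    ; unique  = unique′ (m≤n⇒m<n∨m≡n j≤n)
    }
    where
    τ<1+n = All.map m<n⇒m<1+n bounded
    unique′ : j < n ⊎ j ≡ n → Unique (insertMax n τ j)
    unique′ (inj₁ j<n) = ∷ʳ-unique (setAt-unique j unique n∉τ) (getAt-∉-setAt j unique j<len n≢τⱼ)
      where
      j<len = subst (j <_) (sym length≡) j<n
      n≢τⱼ : n ≢ getAt τ j n
      n≢τⱼ n≡τⱼ = n∉τ (subst (_∈ τ) (sym n≡τⱼ) (getAt-∈ τ j n j<len))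
    unique′ (inj₂ refl) = subst Unique (sym insertMax-last) (∷ʳ-unique unique n∉τ)

bounded-pred : ∀ {n} {xs : List ℕ} → All (_< suc n) xs → n ∉ xs → All (_< n) xs
bounded-pred xs<1+n n∉ =
  All.tabulate λ z∈ → ≤∧≢⇒< (≤-pred (All.lookup xs<1+n z∈)) (λ { refl → n∉ z∈ })

insertMax-injective : ∀ {n τ₁ τ₂ j₁ j₂} → IsPerm n τ₁ → IsPerm n τ₂ → j₁ ≤ n → j₂ ≤ n →
  insertMax n τ₁ j₁ ≡ insertMax n τ₂ j₂ → τ₁ ≡ τ₂ × j₁ ≡ j₂
insertMax-injective {n} {τ₁} {τ₂} {j₁} {j₂} p₁ p₂ j₁≤n j₂≤n eq
  with set≡ , get≡ ← ∷ʳ-injective (setAt τ₁ j₁ n) (setAt τ₂ j₂ n) eq = τ₁≡τ₂ , j₁≡j₂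
  where
  open ≡-Reasoning
  indexOf-n : ∀ {τ j} → IsPerm n τ → j ≤ n → indexOf n (setAt τ j n) ≡ j
  indexOf-n {τ} {j} p j≤n =
    indexOf-setAt τ j (n∉τ p) (subst (j ≤_) (sym (IsPerm.length≡ p)) j≤n)
  restore : ∀ τ j → setAt (setAt τ j n) j (getAt τ j n) ≡ τ
  restore τ j = trans (setAt-setAt τ j n _) (setAt-getAt τ j n)
  j₁≡j₂ : j₁ ≡ j₂
  j₁≡j₂ = begin
    j₁                         ≡⟨ sym (indexOf-n p₁ j₁≤n) ⟩
    indexOf n (setAt τ₁ j₁ n)  ≡⟨ cong (indexOf n) set≡ ⟩
    indexOf n (setAt τ₂ j₂ n)  ≡⟨ indexOf-n p₂ j₂≤n ⟩
    j₂                         ∎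
  τ₁≡τ₂ : τ₁ ≡ τ₂
  τ₁≡τ₂ = begin
    τ₁                                        ≡⟨ sym (restore τ₁ j₁) ⟩
    setAt (setAt τ₁ j₁ n) j₁ (getAt τ₁ j₁ n)  ≡⟨ cong₂ (λ xs y → setAt xs j₁ y) set≡ get≡ ⟩
    setAt (setAt τ₂ j₂ n) j₁ (getAt τ₂ j₂ n)  ≡⟨ cong (λ j → setAt _ j _) j₁≡j₂ ⟩
    setAt (setAt τ₂ j₂ n) j₂ (getAt τ₂ j₂ n)  ≡⟨ restore τ₂ j₂ ⟩
    τ₂                                        ∎

module Preimage {n s a} (σ-perm : IsPerm (suc n) (s ∷ʳ a)) where
  open IsPerm σ-perm

  s-length : length s ≡ n
  s-length = suc-injective (trans (sym (length-∷ʳ s a)) length≡)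

  s<1+n : All (_< suc n) s
  s<1+n = AllP.++⁻ˡ s bounded

  a<1+n : a < suc n
  a<1+n = All.head (AllP.++⁻ʳ s bounded)

  s-unique : Unique s
  s-unique = proj₁ (∷ʳ-unique⁻ s unique)

  a∉s : a ∉ s
  a∉s = proj₂ (∷ʳ-unique⁻ s unique)

  preimage-∈ : (n∈s : n ∈ s) → let j = indexOf n s in
               IsPerm n (setAt s j a) × j ≤ n × insertMax n (setAt s j a) j ≡ s ∷ʳ a
  preimage-∈ n∈s = τ-perm , <⇒≤ (subst (j <_) s-length j<len) , insertMax≡
    where
    j = indexOf n s
    j<len : j < length s
    j<len = indexOf-< n∈s
    sⱼ≡n : getAt s j n ≡ n
    sⱼ≡n = getAt-indexOf n s
    a≢sⱼ : a ≢ getAt s j n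
    a≢sⱼ a≡sⱼ = a∉s (subst (_∈ s) (sym (trans a≡sⱼ sⱼ≡n)) n∈s)
    n∉τ′ : n ∉ setAt s j a
    n∉τ′ n∈ = getAt-∉-setAt j s-unique j<len a≢sⱼ (subst (_∈ setAt s j a) (sym sⱼ≡n) n∈)
    τ-perm : IsPerm n (setAt s j a)
    τ-perm = record
      { length≡ = trans (length-setAt s j a) s-length
      ; bounded = bounded-pred (All-setAt j s<1+n a<1+n) n∉τ′
      ; unique  = setAt-unique j s-unique a∉s
      }
    insertMax≡ : insertMax n (setAt s j a) j ≡ s ∷ʳ a
    insertMax≡ = cong₂ _∷ʳ_
      (trans (setAt-setAt s j a n) (trans (cong (setAt s j) (sym sⱼ≡n)) (setAt-getAt s j n)))
      (getAt-setAt s j a n j<len)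

  -- a ≠ n would leave n + 1 distinct entries below n
  preimage-∉ : n ∉ s → IsPerm n s × n ≤ n × insertMax n s n ≡ s ∷ʳ a
  preimage-∉ n∉s = s-perm , ≤-refl , trans (insertMax-last s-perm) (cong (s ∷ʳ_) (sym a≡n))
    where
    s<n : All (_< n) s
    s<n = bounded-pred s<1+n n∉s
    s-perm : IsPerm n s
    s-perm = record { length≡ = s-length ; bounded = s<n ; unique = s-unique }
    a≡n : a ≡ n
    a≡n with a ≟ n
    ... | yes a≡n = a≡n
    ... | no a≢n  = ⊥-elim (n≮n n (subst (_≤ n) (cong suc s-length)
            (unique-bounded⇒length≤ (All.tabulate (λ { z∈ refl → a∉s z∈ }) ∷ s-unique)
                                    (≤∧≢⇒< (≤-pred a<1+n) a≢n ∷ s<n))))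

insertMax-surjective : ∀ {n σ} → IsPerm (suc n) σ →
                       ∃₂ λ τ j → IsPerm n τ × j ≤ n × insertMax n τ j ≡ σ
insertMax-surjective {n} {σ} σ-perm with initLast σ
... | [] with () ← IsPerm.length≡ σ-perm
... | s ∷ʳ′ a with n ∈? s
...   | yes n∈s = _ , _ , Preimage.preimage-∈ σ-perm n∈s
...   | no n∉s  = _ , _ , Preimage.preimage-∉ σ-perm n∉s

insertions : ℕ → List (List ℕ) → List (List ℕ)
insertions n τs = cartesianProductWith (insertMax n) τs (upTo (suc n))

insertions-unique : ∀ n → Unique (insertions n (perms n))
insertions-unique n = cartesianProductWith-unique (insertMax n)
  (λ τ₁∈ τ₂∈ j₁∈ j₂∈ →
     insertMax-injective (∈-perms⁻ τ₁∈) (∈-perms⁻ τ₂∈) (≤n j₁∈) (≤n j₂∈))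
  (perms-unique n) (Unique.upTo⁺ (suc n))
  where
  ≤n : ∀ {j} → j ∈ upTo (suc n) → j ≤ n
  ≤n = ≤-pred ∘ ∈-upTo⁻

perms-suc↭insertions : ∀ n → perms (suc n) ↭ insertions n (perms n)
perms-suc↭insertions n =
  ∼bag⇒↭ (unique∧set⇒bag (perms-unique (suc n)) (insertions-unique n) (mk⇔ to from))
  where
  to : ∀ {σ} → σ ∈ perms (suc n) → σ ∈ insertions n (perms n)
  to σ∈ with τ , j , τ-perm , j≤n , refl ← insertMax-surjective {n} (∈-perms⁻ σ∈) =
    ∈-cartesianProductWith⁺ (insertMax n) (∈-perms⁺ τ-perm) (∈-upTo⁺ (s≤s j≤n))
  from : ∀ {σ} → σ ∈ insertions n (perms n) → σ ∈ perms (suc n)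
  from σ∈ with τ , j , τ∈ , j∈ , refl ←
                ∈-cartesianProductWith⁻ (insertMax n) (perms n) (upTo (suc n)) σ∈ =
    ∈-perms⁺ (IsPerm-insertMax (∈-perms⁻ τ∈) (≤-pred (∈-upTo⁻ j∈)))

R≡∑ : ∀ n k → R n k ≡ ∑ (perms n) (λ σ → χ (doubleLevels σ ≟ k))
R≡∑ n k = length-filter≡∑χ (λ σ → doubleLevels σ ≟ k) (perms n)

R-suc≡∑ : ∀ n k →
  R (suc n) k ≡
    ∑ (perms n) (λ τ → ∑ (upTo (suc n)) (λ j → χ (doubleLevels (insertMax n τ j) ≟ k)))
R-suc≡∑ n k = begin
  R (suc n) k
    ≡⟨ R≡∑ (suc n) k ⟩
  ∑ (perms (suc n)) f
    ≡⟨ sum-↭ (↭.map⁺ f (perms-suc↭insertions n)) ⟩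
  ∑ (insertions n (perms n)) f
    ≡⟨ ∑-cartesianProductWith (insertMax n) (perms n) (upTo (suc n)) f ⟩
  ∑ (perms n) (λ τ → ∑ (upTo (suc n)) (λ j → f (insertMax n τ j))) ∎
  where
  open ≡-Reasoning
  f : List ℕ → ℕ
  f σ = χ (doubleLevels σ ≟ k)

mult≡occ : ∀ σ v → mult σ v ≡ occ v (levels σ)
mult≡occ σ v = length-filter≡∑χ (_≟ v) (levels σ)

doubleLevels≡∑ : ∀ σ → doubleLevels σ ≡ ∑ (upTo (length σ)) (λ v → χ (mult σ v ≟ 2))
doubleLevels≡∑ σ = length-filter≡∑χ (λ v → mult σ v ≟ 2) (upTo (length σ))

χ⊔≤ : ∀ v i x → χ (i ⊔ x ≟ v) ≤ χ (i ≟ v) + χ (x ≟ v)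
χ⊔≤ v i x with i ⊔ x ≟ v | i ≟ v | x ≟ v
... | no _        | _     | _     = z≤n
... | yes _       | yes _ | _     = s≤s z≤n
... | yes _       | no _  | yes _ = s≤s z≤n
... | yes refl    | no i≢ | no x≢ with ⊔-sel i x
...   | inj₁ i⊔x≡i = ⊥-elim (i≢ (sym i⊔x≡i))
...   | inj₂ i⊔x≡x = ⊥-elim (x≢ (sym i⊔x≡x))

occ-zip⊔≤ : ∀ v is xs →
            occ v (map (λ c → proj₁ c ⊔ proj₂ c) (zip is xs)) ≤ occ v is + occ v xs
occ-zip⊔≤ v []       xs       = z≤n
occ-zip⊔≤ v (i ∷ is) []       = z≤n
occ-zip⊔≤ v (i ∷ is) (x ∷ xs) = ≤-trans (+-mono-≤ (χ⊔≤ v i x) (occ-zip⊔≤ v is xs))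
  (≤-reflexive (interchange (χ (i ≟ v)) (χ (x ≟ v)) (occ v is) (occ v xs)))

mult≤2 : ∀ {σ} v → Unique σ → mult σ v ≤ 2
mult≤2 {σ} v u = begin
  mult σ v                           ≡⟨ mult≡occ σ v ⟩
  occ v (levels σ)                   ≤⟨ occ-zip⊔≤ v (upTo (length σ)) σ ⟩
  occ v (upTo (length σ)) + occ v σ  ≤⟨ +-mono-≤ (occ-unique≤1 indices-unique) (occ-unique≤1 u) ⟩
  2                                  ∎
  where
  open ≤-Reasoning
  indices-unique = Unique.upTo⁺ (length σ)

levelsFrom : ℕ → List ℕ → List ℕ
levelsFrom i []       = []
levelsFrom i (x ∷ xs) = i ⊔ x ∷ levelsFrom (suc i) xs

levels≡levelsFrom : ∀ σ → levels σ ≡ levelsFrom 0 σ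
levels≡levelsFrom σ = go id 0 σ (λ _ → refl)
  where
  go : ∀ f i xs → (∀ x → f x ≡ i + x) →
       map (λ c → proj₁ c ⊔ proj₂ c) (zip (applyUpTo f (length xs)) xs) ≡ levelsFrom i xs
  go f i []       f≗ = refl
  go f i (x ∷ xs) f≗ = cong₂ _∷_ (cong (_⊔ x) (trans (f≗ 0) (+-identityʳ i)))
                                 (go (f ∘ suc) (suc i) xs (λ y → trans (f≗ (suc y)) (+-suc i y)))

length-levelsFrom : ∀ i xs → length (levelsFrom i xs) ≡ length xs
length-levelsFrom i []       = refl
length-levelsFrom i (x ∷ xs) = cong suc (length-levelsFrom (suc i) xs)

levelsFrom-++ : ∀ i xs ys →
                levelsFrom i (xs ++ ys) ≡ levelsFrom i xs ++ levelsFrom (i + length xs) ys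
levelsFrom-++ i []       ys = cong (λ i′ → levelsFrom i′ ys) (sym (+-identityʳ i))
levelsFrom-++ i (x ∷ xs) ys = cong (i ⊔ x ∷_) (trans (levelsFrom-++ (suc i) xs ys)
  (cong (λ i′ → levelsFrom (suc i) xs ++ levelsFrom i′ ys) (sym (+-suc i (length xs)))))

levelsFrom-setAt : ∀ i xs j y → i + j ≤ y →
                   levelsFrom i (setAt xs j y) ≡ setAt (levelsFrom i xs) j y
levelsFrom-setAt i []       j       y _   = refl
levelsFrom-setAt i (x ∷ xs) zero    y i≤y =
  cong (_∷ levelsFrom (suc i) xs) (m≤n⇒m⊔n≡n (subst (_≤ y) (+-identityʳ i) i≤y))
levelsFrom-setAt i (x ∷ xs) (suc j) y i≤y =
  cong (i ⊔ x ∷_) (levelsFrom-setAt (suc i) xs j y (subst (_≤ y) (+-suc i j) i≤y))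

levelsFrom-bounded : ∀ {b} i xs → All (_< b) xs → i + length xs ≤ b →
                     All (_< b) (levelsFrom i xs)
levelsFrom-bounded     i []       []            _  = []
levelsFrom-bounded {b} i (x ∷ xs) (x<b ∷ xs<b) ≤b =
  ⊔-lub i<b x<b ∷ levelsFrom-bounded (suc i) xs xs<b 1+i+len≤b
  where
  1+i+len≤b : suc i + length xs ≤ b
  1+i+len≤b = subst (_≤ b) (+-suc i (length xs)) ≤b
  i<b : i < b
  i<b = ≤-trans (s≤s (m≤m+n i (length xs))) 1+i+len≤b

-- Double levels after one insertion

χ-≢ : ∀ {x y : ℕ} → x ≢ y → χ (x ≟ y) ≡ 0
χ-≢ {x} {y} x≢y with x ≟ y
... | yes x≡y = ⊥-elim (x≢y x≡y)
... | no _    = refl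

χ-≡ : ∀ {x y : ℕ} → x ≡ y → χ (x ≟ y) ≡ 1
χ-≡ {x} {y} x≡y with x ≟ y
... | yes _   = refl
... | no x≢y  = ⊥-elim (x≢y x≡y)

χ-suc : ∀ x y → χ (suc x ≟ suc y) ≡ χ (x ≟ y)
χ-suc x y with x ≟ y
... | yes x≡y = χ-≡ (cong suc x≡y)
... | no x≢y  = χ-≢ (x≢y ∘ suc-injective)

χ-scale : ∀ x y → x * χ (x ≟ y) ≡ y * χ (x ≟ y)
χ-scale x y with x ≟ y
... | yes x≡y = cong (_* 1) x≡y
... | no _    = trans (*-zeroʳ x) (sym (*-zeroʳ y))

-- A value of multiplicity y ≤ 2 that loses χ d of its occurrences is double afterwards
-- exactly when it was double before and was not hit.
χ≟2-removal : ∀ x y {A : Set} (d : Dec A) → x + χ d ≡ y → y ≤ 2 →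
              χ (x ≟ 2) + χ d * χ (y ≟ 2) ≡ χ (y ≟ 2)
χ≟2-removal x y (no _)  refl _    =
  trans (+-identityʳ _) (cong (λ z → χ (z ≟ 2)) (sym (+-identityʳ x)))
χ≟2-removal x y (yes _) x+1≡y y≤2 = cong₂ _+_ (χ-≢ (<⇒≢ x<2)) (*-identityˡ _)
  where
  x<2 : x < 2
  x<2 = subst (_≤ 2) (trans (sym x+1≡y) (+-comm x 1)) y≤2

χ-step : ∀ x b D k → b ≤ 1 → x + b ≡ suc D →
         χ (x ≟ k) + χ (suc D ≟ k) * b ≡ χ (D ≟ k) * b + χ (suc D ≟ k)
χ-step x zero          D k _ x+0≡1+D
  rewrite +-identityʳ x | x+0≡1+D | *-zeroʳ (χ (suc D ≟ k)) | *-zeroʳ (χ (D ≟ k))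
  = +-identityʳ _
χ-step x (suc zero)    D k _ x+1≡1+D
  rewrite +-comm x 1 | suc-injective x+1≡1+D | *-identityʳ (χ (suc D ≟ k)) | *-identityʳ (χ (D ≟ k))
  = refl
χ-step x (suc (suc b)) D k (s≤s ()) _

module Insertion {n τ} (τ-perm : IsPerm n τ) where
  open IsPerm τ-perm
  open ≡-Reasoning

  L : List ℕ
  L = levels τ

  L-length : length L ≡ n
  L-length = trans (cong length (levels≡levelsFrom τ)) (trans (length-levelsFrom 0 τ) length≡)

  L-bounded : All (_< n) L
  L-bounded = subst (All (_< n)) (sym (levels≡levelsFrom τ))
                    (levelsFrom-bounded 0 τ bounded (≤-reflexive length≡))

  -- the level of column j of τ, and the default n for j = n
  ℓ : ℕ → ℕ
  ℓ j = getAt L j n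

  P : ℕ → ℕ
  P v = χ (mult τ v ≟ 2)

  D : ℕ
  D = doubleLevels τ

  D≡∑P : D ≡ ∑ (upTo n) P
  D≡∑P = trans (doubleLevels≡∑ τ) (cong (λ m → ∑ (upTo m) P) length≡)

  levels-insertMax : ∀ {j} → j ≤ n → levels (insertMax n τ j) ≡ setAt L j n ∷ʳ n
  levels-insertMax {j} j≤n = begin
    levels (insertMax n τ j)
      ≡⟨ levels≡levelsFrom (insertMax n τ j) ⟩
    levelsFrom 0 (setAt τ j n ∷ʳ getAt τ j n)
      ≡⟨ levelsFrom-++ 0 (setAt τ j n) _ ⟩
    levelsFrom 0 (setAt τ j n) ∷ʳ (length (setAt τ j n) ⊔ getAt τ j n)
      ≡⟨ cong₂ _∷ʳ_ (levelsFrom-setAt 0 τ j n j≤n) last≡n ⟩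
    setAt (levelsFrom 0 τ) j n ∷ʳ n
      ≡⟨ cong (λ xs → setAt xs j n ∷ʳ n) (sym (levels≡levelsFrom τ)) ⟩
    setAt L j n ∷ʳ n ∎
    where
    last≡n : length (setAt τ j n) ⊔ getAt τ j n ≡ n
    last≡n = trans (cong (_⊔ getAt τ j n) (trans (length-setAt τ j n) length≡))
                   (m≥n⇒m⊔n≡m (All-getAt j (All.map <⇒≤ bounded) ≤-refl))

  mult-insertMax : ∀ {j} → j ≤ n → ∀ v →
                   mult (insertMax n τ j) v + χ (ℓ j ≟ v) ≡ mult τ v + 2 * χ (n ≟ v)
  mult-insertMax {j} j≤n v = begin
    mult (insertMax n τ j) v + χ (ℓ j ≟ v)
      ≡⟨ cong (_+ χ (ℓ j ≟ v)) (mult≡occ (insertMax n τ j) v) ⟩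
    occ v (levels (insertMax n τ j)) + χ (ℓ j ≟ v)
      ≡⟨ cong (λ ls → occ v ls + χ (ℓ j ≟ v)) (levels-insertMax j≤n) ⟩
    occ v (setAt L j n ∷ʳ n) + χ (ℓ j ≟ v)
      ≡⟨ cong (_+ χ (ℓ j ≟ v)) (∑-++ (setAt L j n) (n ∷ []) _) ⟩
    occ v (setAt L j n) + (χ (n ≟ v) + 0) + χ (ℓ j ≟ v)
      ≡⟨ swap (occ v (setAt L j n)) (χ (n ≟ v)) (χ (ℓ j ≟ v)) ⟩
    occ v (setAt L j n) + χ (ℓ j ≟ v) + χ (n ≟ v)
      ≡⟨ cong (_+ χ (n ≟ v)) (occ-setAt v L j n) ⟩
    occ v L + χ (n ≟ v) + χ (n ≟ v)
      ≡⟨ cong (λ m → m + χ (n ≟ v) + χ (n ≟ v)) (sym (mult≡occ τ v)) ⟩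
    mult τ v + χ (n ≟ v) + χ (n ≟ v)
      ≡⟨ double (mult τ v) (χ (n ≟ v)) ⟩
    mult τ v + 2 * χ (n ≟ v) ∎
    where
    swap : ∀ a b c → a + (b + 0) + c ≡ a + c + b
    swap = solve-∀
    double : ∀ a b → a + b + b ≡ a + 2 * b
    double = solve-∀

  n∉L : n ∉ L
  n∉L n∈ = n≮n n (All.lookup L-bounded n∈)

  mult-insertMax-< : ∀ {j v} → j ≤ n → v < n →
                     mult (insertMax n τ j) v + χ (ℓ j ≟ v) ≡ mult τ v
  mult-insertMax-< {j} {v} j≤n v<n = trans (mult-insertMax j≤n v)
    (trans (cong (λ c → mult τ v + 2 * c) (χ-≢ (>⇒≢ v<n))) (+-identityʳ (mult τ v)))

  mult-insertMax-n : ∀ {j} → j ≤ n → mult (insertMax n τ j) n + χ (ℓ j ≟ n) ≡ 2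
  mult-insertMax-n {j} j≤n =
    trans (mult-insertMax j≤n n) (cong₂ _+_ mult-n≡0 (cong (2 *_) (χ-≡ {n} refl)))
    where mult-n≡0 = trans (mult≡occ τ n) (occ-∉ L n∉L)

  Q : ℕ → ℕ → ℕ
  Q j v = χ (mult (insertMax n τ j) v ≟ 2)

  doubleLevels-insertMax : ∀ {j} → j ≤ n →
                           doubleLevels (insertMax n τ j) ≡ ∑ (upTo n) (Q j) + Q j n
  doubleLevels-insertMax {j} j≤n = begin
    doubleLevels (insertMax n τ j)           ≡⟨ doubleLevels≡∑ (insertMax n τ j) ⟩
    ∑ (upTo (length (insertMax n τ j))) (Q j) ≡⟨ cong (λ m → ∑ (upTo m) (Q j)) length≡suc-n ⟩
    ∑ (upTo (suc n)) (Q j)                   ≡⟨ ∑-upTo-suc n (Q j) ⟩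
    ∑ (upTo n) (Q j) + Q j n                 ∎
    where length≡suc-n = IsPerm.length≡ (IsPerm-insertMax τ-perm j≤n)

  ∑Q+∑δP≡D : ∀ {j} → j ≤ n →
             ∑ (upTo n) (Q j) + ∑ (upTo n) (λ v → χ (ℓ j ≟ v) * P v) ≡ D
  ∑Q+∑δP≡D {j} j≤n = begin
    ∑ (upTo n) (Q j) + ∑ (upTo n) (λ v → χ (ℓ j ≟ v) * P v)
      ≡⟨ sym (∑-+ (upTo n) _ _) ⟩
    ∑ (upTo n) (λ v → Q j v + χ (ℓ j ≟ v) * P v)
      ≡⟨ ∑-cong (upTo n) (λ {v} v∈ →
           χ≟2-removal _ _ (ℓ j ≟ v) (mult-insertMax-< j≤n (∈-upTo⁻ v∈)) (mult≤2 v unique)) ⟩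
    ∑ (upTo n) P
      ≡⟨ sym D≡∑P ⟩
    D ∎

  doubleLevels-insertMax-< : ∀ {j} → j < n → doubleLevels (insertMax n τ j) + P (ℓ j) ≡ suc D
  doubleLevels-insertMax-< {j} j<n = begin
    doubleLevels (insertMax n τ j) + P (ℓ j)
      ≡⟨ cong₂ _+_ (doubleLevels-insertMax (<⇒≤ j<n)) (sym (∑-δ P (Unique.upTo⁺ n) ℓj∈)) ⟩
    ∑ (upTo n) (Q j) + Q j n + ∑δP
      ≡⟨ cong (λ q → ∑ (upTo n) (Q j) + q + ∑δP) Qjn≡1 ⟩
    ∑ (upTo n) (Q j) + 1 + ∑δP
      ≡⟨ +-suc-right (∑ (upTo n) (Q j)) ∑δP ⟩
    suc (∑ (upTo n) (Q j) + ∑δP)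
      ≡⟨ cong suc (∑Q+∑δP≡D (<⇒≤ j<n)) ⟩
    suc D ∎
    where
    ∑δP = ∑ (upTo n) (λ v → χ (ℓ j ≟ v) * P v)
    ℓj<n : ℓ j < n
    ℓj<n = All.lookup L-bounded (getAt-∈ L j n (subst (j <_) (sym L-length) j<n))
    ℓj∈ = ∈-upTo⁺ ℓj<n
    mult≡2 : mult (insertMax n τ j) n ≡ 2
    mult≡2 = trans (sym (+-identityʳ _)) (trans (cong (mult (insertMax n τ j) n +_) (sym (χ-≢ (<⇒≢ ℓj<n))))
                                               (mult-insertMax-n (<⇒≤ j<n)))
    Qjn≡1 : Q j n ≡ 1
    Qjn≡1 = cong (λ m → χ (m ≟ 2)) mult≡2
    +-suc-right : ∀ a b → a + 1 + b ≡ suc (a + b)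
    +-suc-right = solve-∀

  doubleLevels-insertMax-last : doubleLevels (insertMax n τ n) ≡ D
  doubleLevels-insertMax-last = begin
    doubleLevels (insertMax n τ n)
      ≡⟨ doubleLevels-insertMax ≤-refl ⟩
    ∑ (upTo n) (Q n) + Q n n
      ≡⟨ cong (∑ (upTo n) (Q n) +_) (trans Qnn≡0 (sym (∑-δ-∉ (upTo n) P ℓn∉))) ⟩
    ∑ (upTo n) (Q n) + ∑ (upTo n) (λ v → χ (ℓ n ≟ v) * P v)
      ≡⟨ ∑Q+∑δP≡D ≤-refl ⟩
    D ∎
    where
    ℓn≡n : ℓ n ≡ n
    ℓn≡n = getAt-≥ L n n (≤-reflexive L-length)
    ℓn∉ : ℓ n ∉ upTo n
    ℓn∉ ℓn∈ = n≮n n (subst (_< n) ℓn≡n (∈-upTo⁻ ℓn∈))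
    mult≡1 : mult (insertMax n τ n) n ≡ 1
    mult≡1 = suc-injective (trans (+-comm 1 _)
      (trans (cong (mult (insertMax n τ n) n +_) (sym (χ-≡ ℓn≡n))) (mult-insertMax-n ≤-refl)))
    Qnn≡0 : Q n n ≡ 0
    Qnn≡0 = cong (λ m → χ (m ≟ 2)) mult≡1

  ∑P∘ℓ≡2D : ∑ (upTo n) (P ∘ ℓ) ≡ 2 * D
  ∑P∘ℓ≡2D = begin
    ∑ (upTo n) (P ∘ ℓ)                ≡⟨ cong (λ m → ∑ (upTo m) (P ∘ ℓ)) (sym L-length) ⟩
    ∑ (upTo (length L)) (P ∘ ℓ)       ≡⟨ sym (∑-map ℓ (upTo (length L)) P) ⟩
    ∑ (map ℓ (upTo (length L))) P     ≡⟨ cong (λ xs → ∑ xs P) (map-getAt-upTo L n) ⟩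
    ∑ L P                             ≡⟨ ∑-by-occ n P L L-bounded ⟩
    ∑ (upTo n) (λ v → occ v L * P v)  ≡⟨ ∑-cong (upTo n) (λ {v} _ → occ*P≡2*P v) ⟩
    ∑ (upTo n) (λ v → 2 * P v)        ≡⟨ ∑-*ˡ (upTo n) 2 P ⟩
    2 * ∑ (upTo n) P                  ≡⟨ cong (2 *_) (sym D≡∑P) ⟩
    2 * D                             ∎
    where
    occ*P≡2*P : ∀ v → occ v L * P v ≡ 2 * P v
    occ*P≡2*P v = trans (cong (_* P v) (sym (mult≡occ τ v))) (χ-scale (mult τ v) 2)

  N : ℕ → ℕ
  N k = ∑ (upTo (suc n)) (λ j → χ (doubleLevels (insertMax n τ j) ≟ k))

  N-count : ∀ k → N k + 2 * D * χ (suc D ≟ k) ≡ (1 + 2 * D) * χ (D ≟ k) + n * χ (suc D ≟ k)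
  N-count k = begin
    ∑ (upTo (suc n)) h + 2 * D * X
      ≡⟨ cong₂ _+_ (∑-upTo-suc n h) (cong (_* X) (sym ∑P∘ℓ≡2D)) ⟩
    ∑ (upTo n) h + h n + ∑ (upTo n) (P ∘ ℓ) * X
      ≡⟨ cong₂ (λ a b → ∑ (upTo n) h + a + b) h-last (*-comm _ X) ⟩
    ∑ (upTo n) h + Y + X * ∑ (upTo n) (P ∘ ℓ)
      ≡⟨ cong (∑ (upTo n) h + Y +_) (sym (∑-*ˡ (upTo n) X (P ∘ ℓ))) ⟩
    ∑ (upTo n) h + Y + ∑ (upTo n) (λ j → X * P (ℓ j))
      ≡⟨ trans (swap (∑ (upTo n) h) Y _) (cong (Y +_) (sym (∑-+ (upTo n) h _))) ⟩
    Y + ∑ (upTo n) (λ j → h j + X * P (ℓ j))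
      ≡⟨ cong (Y +_) (∑-cong (upTo n) (λ j∈ →
           χ-step _ _ D k (χ≤1 _) (doubleLevels-insertMax-< (∈-upTo⁻ j∈)))) ⟩
    Y + ∑ (upTo n) (λ j → Y * P (ℓ j) + X)
      ≡⟨ cong (Y +_) (trans (∑-+ (upTo n) _ _)
                             (cong₂ _+_ (∑-*ˡ (upTo n) Y (P ∘ ℓ)) (∑-const (upTo n) X))) ⟩
    Y + (Y * ∑ (upTo n) (P ∘ ℓ) + length (upTo n) * X)
      ≡⟨ cong₂ (λ s m → Y + (Y * s + m * X)) ∑P∘ℓ≡2D (length-upTo n) ⟩
    Y + (Y * (2 * D) + n * X)
      ≡⟨ collect Y D n X ⟩
    (1 + 2 * D) * Y + n * X ∎
    where
    h : ℕ → ℕ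
    h j = χ (doubleLevels (insertMax n τ j) ≟ k)
    X = χ (suc D ≟ k)
    Y = χ (D ≟ k)
    h-last : h n ≡ Y
    h-last = cong (λ d → χ (d ≟ k)) doubleLevels-insertMax-last
    swap : ∀ a y b → a + y + b ≡ y + (a + b)
    swap = solve-∀
    collect : ∀ y d m x → y + (y * (2 * d) + m * x) ≡ (1 + 2 * d) * y + m * x
    collect = solve-∀

  N-zero : N 0 ≡ χ (D ≟ 0)
  N-zero = begin
    N 0                              ≡⟨ sym (+-identityʳ (N 0)) ⟩
    N 0 + 0                          ≡⟨ cong (N 0 +_) (sym (*-zeroʳ (2 * D))) ⟩
    N 0 + 2 * D * 0                  ≡⟨ N-count 0 ⟩
    (1 + 2 * D) * Y + n * 0          ≡⟨ cong₂ _+_ (distrib D Y) (*-zeroʳ n) ⟩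
    Y + 2 * (D * Y) + 0              ≡⟨ cong (λ z → Y + 2 * z + 0) (χ-scale D 0) ⟩
    Y + 2 * 0 + 0                    ≡⟨ cancel Y ⟩
    Y                                ∎
    where
    Y = χ (D ≟ 0)
    distrib : ∀ d y → (1 + 2 * d) * y ≡ y + 2 * (d * y)
    distrib = solve-∀
    cancel : ∀ y → y + 2 * 0 + 0 ≡ y
    cancel = solve-∀

  N-suc : ∀ k → N (suc k) + 2 * k * χ (D ≟ k) ≡ (3 + 2 * k) * χ (D ≟ suc k) + n * χ (D ≟ k)
  N-suc k = begin
    N (suc k) + 2 * k * X
      ≡⟨ cong (N (suc k) +_) (trans (*-assoc 2 k X) (cong (2 *_) (sym (χ-scale D k)))) ⟩
    N (suc k) + 2 * (D * X)
      ≡⟨ cong (λ x → N (suc k) + 2 * (D * x)) (sym (χ-suc D k)) ⟩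
    N (suc k) + 2 * (D * χ (suc D ≟ suc k))
      ≡⟨ cong (N (suc k) +_) (sym (*-assoc 2 D _)) ⟩
    N (suc k) + 2 * D * χ (suc D ≟ suc k)
      ≡⟨ N-count (suc k) ⟩
    (1 + 2 * D) * Y + n * χ (suc D ≟ suc k)
      ≡⟨ cong₂ _+_ (distrib D Y) (cong (n *_) (χ-suc D k)) ⟩
    Y + 2 * (D * Y) + n * X
      ≡⟨ cong (λ z → Y + 2 * z + n * X) (χ-scale D (suc k)) ⟩
    Y + 2 * (suc k * Y) + n * X
      ≡⟨ cong (_+ n * X) (collect k Y) ⟩
    (3 + 2 * k) * Y + n * X ∎
    where
    X = χ (D ≟ k)
    Y = χ (D ≟ suc k)
    distrib : ∀ d y → (1 + 2 * d) * y ≡ y + 2 * (d * y)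
    distrib = solve-∀
    collect : ∀ k y → y + 2 * (suc k * y) ≡ (3 + 2 * k) * y
    collect = solve-∀

-- The recurrences

R-suc-zero : ∀ n → R (suc n) 0 ≡ R n 0
R-suc-zero n = begin
  R (suc n) 0
    ≡⟨ R-suc≡∑ n 0 ⟩
  ∑ (perms n) (λ τ → ∑ (upTo (suc n)) (λ j → χ (doubleLevels (insertMax n τ j) ≟ 0)))
    ≡⟨ ∑-cong (perms n) (λ τ∈ → Insertion.N-zero (∈-perms⁻ τ∈)) ⟩
  ∑ (perms n) (λ τ → χ (doubleLevels τ ≟ 0))
    ≡⟨ sym (R≡∑ n 0) ⟩
  R n 0 ∎
  where open ≡-Reasoning

R-suc-suc : ∀ n k → R (suc n) (suc k) + 2 * k * R n k ≡ (3 + 2 * k) * R n (suc k) + n * R n k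
R-suc-suc n k = begin
  R (suc n) (suc k) + 2 * k * R n k
    ≡⟨ cong₂ (λ a b → a + 2 * k * b) (R-suc≡∑ n (suc k)) (R≡∑ n k) ⟩
  ∑ (perms n) N + 2 * k * ∑ (perms n) (χ≟ k)
    ≡⟨ cong (∑ (perms n) N +_) (sym (∑-*ˡ (perms n) (2 * k) (χ≟ k))) ⟩
  ∑ (perms n) N + ∑ (perms n) (λ τ → 2 * k * χ≟ k τ)
    ≡⟨ sym (∑-+ (perms n) N _) ⟩
  ∑ (perms n) (λ τ → N τ + 2 * k * χ≟ k τ)
    ≡⟨ ∑-cong (perms n) (λ τ∈ → Insertion.N-suc (∈-perms⁻ τ∈) k) ⟩
  ∑ (perms n) (λ τ → (3 + 2 * k) * χ≟ (suc k) τ + n * χ≟ k τ)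
    ≡⟨ ∑-+ (perms n) _ _ ⟩
  ∑ (perms n) (λ τ → (3 + 2 * k) * χ≟ (suc k) τ) + ∑ (perms n) (λ τ → n * χ≟ k τ)
    ≡⟨ cong₂ _+_ (∑-*ˡ (perms n) (3 + 2 * k) (χ≟ (suc k))) (∑-*ˡ (perms n) n (χ≟ k)) ⟩
  (3 + 2 * k) * ∑ (perms n) (χ≟ (suc k)) + n * ∑ (perms n) (χ≟ k)
    ≡⟨ sym (cong₂ (λ a b → (3 + 2 * k) * a + n * b) (R≡∑ n (suc k)) (R≡∑ n k)) ⟩
  (3 + 2 * k) * R n (suc k) + n * R n k ∎
  where
  open ≡-Reasoning
  χ≟ : ℕ → List ℕ → ℕ
  χ≟ k σ = χ (doubleLevels σ ≟ k)
  N : List ℕ → ℕ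
  N τ = ∑ (upTo (suc n)) (λ j → χ≟ (suc k) (insertMax n τ j))

-- Coefficients of the series

/-≡ : ∀ p q m d .{{_ : NonZero m}} .{{_ : NonZero d}} →
      p ℤ.* ℤ.+ d ≡ q ℤ.* ℤ.+ m → p / m ≡ q / d
/-≡ p q (suc m) (suc d) eq = ℚP.fromℚᵘ-cong {mkℚᵘ p m} {mkℚᵘ q d} (*≡* eq)

toℚᵘ-/ : ∀ p d → ℚ.toℚᵘ (p / suc d) ℚᵘ.≃ mkℚᵘ p d
toℚᵘ-/ p d = ℚP.toℚᵘ-fromℚᵘ (mkℚᵘ p d)

/-*-/ : ∀ p q m d .{{_ : NonZero m}} .{{_ : NonZero d}} →
        (p / m) ℚ.* (q / d) ≡ _/_ (p ℤ.* q) (m * d) {{m*n≢0 m d}}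
/-*-/ p q (suc m) (suc d) = ℚP.toℚᵘ-injective (begin-equality
  ℚ.toℚᵘ ((p / suc m) ℚ.* (q / suc d))        ≃⟨ ℚP.toℚᵘ-homo-* (p / suc m) (q / suc d) ⟩
  ℚ.toℚᵘ (p / suc m) ℚᵘ.* ℚ.toℚᵘ (q / suc d)  ≃⟨ ℚᵘP.*-cong (toℚᵘ-/ p m) (toℚᵘ-/ q d) ⟩
  mkℚᵘ p m ℚᵘ.* mkℚᵘ q d                      ≃⟨ toℚᵘ-/ (p ℤ.* q) _ ⟨
  ℚ.toℚᵘ ((p ℤ.* q) / (suc m * suc d))        ∎)
  where open ℚᵘP.≤-Reasoning

/-+-/ : ∀ p q m d .{{_ : NonZero m}} .{{_ : NonZero d}} →
        (p / m) ℚ.+ (q / d) ≡ _/_ (p ℤ.* ℤ.+ d ℤ.+ q ℤ.* ℤ.+ m) (m * d) {{m*n≢0 m d}}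
/-+-/ p q (suc m) (suc d) = ℚP.toℚᵘ-injective (begin-equality
  ℚ.toℚᵘ ((p / suc m) ℚ.+ (q / suc d))        ≃⟨ ℚP.toℚᵘ-homo-+ (p / suc m) (q / suc d) ⟩
  ℚ.toℚᵘ (p / suc m) ℚᵘ.+ ℚ.toℚᵘ (q / suc d)  ≃⟨ ℚᵘP.+-cong (toℚᵘ-/ p m) (toℚᵘ-/ q d) ⟩
  mkℚᵘ p m ℚᵘ.+ mkℚᵘ q d                      ≃⟨ ℚP.toℚᵘ-fromℚᵘ _ ⟨
  ℚ.toℚᵘ ((p ℤ.* ℤ.+ suc d ℤ.+ q ℤ.* ℤ.+ suc m) / (suc m * suc d)) ∎)
  where open ℚᵘP.≤-Reasoning

ℕ→ℚ-+ : ∀ a b → ℕ→ℚ (a + b) ≡ ℕ→ℚ a ℚ.+ ℕ→ℚ b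
ℕ→ℚ-+ a b = sym (trans (/-+-/ (ℤ.+ a) (ℤ.+ b) 1 1)
  (/-≡ (ℤ.+ a ℤ.* ℤ.+ 1 ℤ.+ ℤ.+ b ℤ.* ℤ.+ 1) (ℤ.+ (a + b)) 1 1
       (trans (identity (ℤ.+ a) (ℤ.+ b)) (cong (ℤ._* ℤ.+ 1) (sym (ℤP.pos-+ a b))))))
  where
  identity : ∀ x y → (x ℤ.* ℤ.+ 1 ℤ.+ y ℤ.* ℤ.+ 1) ℤ.* ℤ.+ 1 ≡ (x ℤ.+ y) ℤ.* ℤ.+ 1
  identity = ℤ-solve-∀

ℕ→ℚ-* : ∀ a b → ℕ→ℚ (a * b) ≡ ℕ→ℚ a ℚ.* ℕ→ℚ b
ℕ→ℚ-* a b = sym (trans (/-*-/ (ℤ.+ a) (ℤ.+ b) 1 1)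
  (/-≡ (ℤ.+ a ℤ.* ℤ.+ b) (ℤ.+ (a * b)) 1 1 (cong (ℤ._* ℤ.+ 1) (sym (ℤP.pos-* a b)))))

/-split : ∀ a m .{{_ : NonZero m}} → ℤ.+ a / m ≡ ℕ→ℚ a ℚ.* (ℤ.+ 1 / m)
/-split a m = sym (trans (/-*-/ (ℤ.+ a) (ℤ.+ 1) 1 m)
                         (/-≡ (ℤ.+ a ℤ.* ℤ.+ 1) (ℤ.+ a) (1 * m) m {{m*n≢0 1 m}} eq))
  where
  eq : ℤ.+ a ℤ.* ℤ.+ 1 ℤ.* ℤ.+ m ≡ ℤ.+ a ℤ.* ℤ.+ (1 * m)
  eq = cong₂ (λ x y → x ℤ.* ℤ.+ y) (ℤP.*-identityʳ (ℤ.+ a)) (sym (*-identityˡ m))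

/-cancel : ∀ a k m .{{_ : NonZero k}} .{{_ : NonZero m}} →
           ℕ→ℚ k ℚ.* _/_ (ℤ.+ a) (k * m) {{m*n≢0 k m}} ≡ ℤ.+ a / m
/-cancel a k m = trans (/-*-/ (ℤ.+ k) (ℤ.+ a) 1 (k * m) {{_}} {{k*m≢0}})
  (/-≡ (ℤ.+ k ℤ.* ℤ.+ a) (ℤ.+ a) (1 * (k * m)) m {{m*n≢0 1 (k * m) {{_}} {{k*m≢0}}}} eq)
  where
  k*m≢0 = m*n≢0 k m
  rearrange : ∀ x y z → x ℤ.* y ℤ.* z ≡ y ℤ.* (x ℤ.* z)
  rearrange = ℤ-solve-∀
  eq : ℤ.+ k ℤ.* ℤ.+ a ℤ.* ℤ.+ m ≡ ℤ.+ a ℤ.* ℤ.+ (1 * (k * m))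
  eq = trans (rearrange (ℤ.+ k) (ℤ.+ a) (ℤ.+ m))
             (cong (ℤ.+ a ℤ.*_) (trans (sym (ℤP.pos-* k m)) (cong ℤ.+_ (sym (*-identityˡ (k * m))))))

1/_! : ℕ → ℚ
1/ n ! = _/_ (ℤ.+ 1) (n !) {{n !≢0}}

𝓡≡R·1/n! : ∀ n k → 𝓡 n k ≡ ℕ→ℚ (R n k) ℚ.* 1/ n !
𝓡≡R·1/n! n k = /-split (R n k) (n !) {{n !≢0}}

∂x𝓡≡R·1/n! : ∀ n k → ∂x 𝓡 n k ≡ ℕ→ℚ (R (suc n) k) ℚ.* 1/ n !
∂x𝓡≡R·1/n! n k = trans (/-cancel (R (suc n) k) (suc n) (n !) {{_}} {{n !≢0}})
                       (/-split (R (suc n) k) (n !) {{n !≢0}})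

mulX-mulY-comm : ∀ F n k → mulX (mulY F) n k ≡ mulY (mulX F) n k
mulX-mulY-comm F zero    zero    = refl
mulX-mulY-comm F zero    (suc k) = refl
mulX-mulY-comm F (suc n) zero    = refl
mulX-mulY-comm F (suc n) (suc k) = refl

mulX-∂x : ∀ F n k → mulX (∂x F) n k ≡ ℕ→ℚ n ℚ.* F n k
mulX-∂x F zero    k = sym (ℚP.*-zeroˡ (F 0 k))
mulX-∂x F (suc n) k = refl

mulY-∂y : ∀ F n k → mulY (∂y F) n k ≡ ℕ→ℚ k ℚ.* F n k
mulY-∂y F n zero    = sym (ℚP.*-zeroˡ (F n 0))
mulY-∂y F n (suc k) = refl

𝓛 : FPS → FPS
𝓛 F = (F ⊖ (ℕ→ℚ 2 · (mulY (mulY (∂y F)) ⊖ mulY (∂y F))))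
    ⊕ (mulX (mulY (∂x F)) ⊖ ∂x F)

𝓛-zero : ∀ F n → 𝓛 F n 0 ≡ (F n 0 ℚ.- ℕ→ℚ 2 ℚ.* (0ℚ ℚ.- 0ℚ)) ℚ.+ (0ℚ ℚ.- ∂x F n 0)
𝓛-zero F n = cong (λ z → (F n 0 ℚ.- ℕ→ℚ 2 ℚ.* (0ℚ ℚ.- 0ℚ)) ℚ.+ (z ℚ.- ∂x F n 0))
                  (mulX-mulY-comm (∂x F) n 0)

𝓛-suc : ∀ F n k → 𝓛 F n (suc k) ≡
  (F n (suc k) ℚ.- ℕ→ℚ 2 ℚ.* (ℕ→ℚ k ℚ.* F n k ℚ.- ℕ→ℚ (suc k) ℚ.* F n (suc k)))
    ℚ.+ (ℕ→ℚ n ℚ.* F n k ℚ.- ∂x F n (suc k))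
𝓛-suc F n k = cong₂ (λ y x → (F n (suc k) ℚ.- ℕ→ℚ 2 ℚ.* (y ℚ.- ℕ→ℚ (suc k) ℚ.* F n (suc k)))
                               ℚ.+ (x ℚ.- ∂x F n (suc k)))
  (mulY-∂y F n k) (trans (mulX-mulY-comm (∂x F) n (suc k)) (mulX-∂x F n k))

R-suc-suc-ℚ : ∀ n k →
  ℕ→ℚ (R (suc n) (suc k)) ℚ.+ ℕ→ℚ 2 ℚ.* ℕ→ℚ k ℚ.* ℕ→ℚ (R n k)
    ≡ (ℕ→ℚ 3 ℚ.+ ℕ→ℚ 2 ℚ.* ℕ→ℚ k) ℚ.* ℕ→ℚ (R n (suc k))
      ℚ.+ ℕ→ℚ n ℚ.* ℕ→ℚ (R n k)
R-suc-suc-ℚ n k = begin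
  ℕ→ℚ (R (suc n) (suc k)) ℚ.+ ℕ→ℚ 2 ℚ.* ℕ→ℚ k ℚ.* ℕ→ℚ (R n k)
    ≡⟨ cong (ℕ→ℚ (R (suc n) (suc k)) ℚ.+_) (sym (ℕ→ℚ-*³ 2 k (R n k))) ⟩
  ℕ→ℚ (R (suc n) (suc k)) ℚ.+ ℕ→ℚ (2 * k * R n k)
    ≡⟨ sym (ℕ→ℚ-+ (R (suc n) (suc k)) (2 * k * R n k)) ⟩
  ℕ→ℚ (R (suc n) (suc k) + 2 * k * R n k)
    ≡⟨ cong ℕ→ℚ (R-suc-suc n k) ⟩
  ℕ→ℚ ((3 + 2 * k) * R n (suc k) + n * R n k)
    ≡⟨ ℕ→ℚ-+ ((3 + 2 * k) * R n (suc k)) (n * R n k) ⟩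
  ℕ→ℚ ((3 + 2 * k) * R n (suc k)) ℚ.+ ℕ→ℚ (n * R n k)
    ≡⟨ cong₂ ℚ._+_ (ℕ→ℚ-* (3 + 2 * k) (R n (suc k))) (ℕ→ℚ-* n (R n k)) ⟩
  ℕ→ℚ (3 + 2 * k) ℚ.* ℕ→ℚ (R n (suc k)) ℚ.+ ℕ→ℚ n ℚ.* ℕ→ℚ (R n k)
    ≡⟨ cong (λ z → z ℚ.* ℕ→ℚ (R n (suc k)) ℚ.+ ℕ→ℚ n ℚ.* ℕ→ℚ (R n k)) 3+2k ⟩
  (ℕ→ℚ 3 ℚ.+ ℕ→ℚ 2 ℚ.* ℕ→ℚ k) ℚ.* ℕ→ℚ (R n (suc k)) ℚ.+ ℕ→ℚ n ℚ.* ℕ→ℚ (R n k) ∎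
  where
  open ≡-Reasoning
  ℕ→ℚ-*³ : ∀ a b c → ℕ→ℚ (a * b * c) ≡ ℕ→ℚ a ℚ.* ℕ→ℚ b ℚ.* ℕ→ℚ c
  ℕ→ℚ-*³ a b c = trans (ℕ→ℚ-* (a * b) c) (cong (ℚ._* ℕ→ℚ c) (ℕ→ℚ-* a b))
  3+2k : ℕ→ℚ (3 + 2 * k) ≡ ℕ→ℚ 3 ℚ.+ ℕ→ℚ 2 ℚ.* ℕ→ℚ k
  3+2k = trans (ℕ→ℚ-+ 3 (2 * k)) (cong (ℕ→ℚ 3 ℚ.+_) (ℕ→ℚ-* 2 k))

-- With a = R n (k+1), b = R n k, c = R (n+1) (k+1) and w = 1/n!, the coefficient 𝓛 𝓡 n (k+1)
-- is w times the difference of the two sides of R-suc-suc.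
𝓛-suc-vanishes : ∀ (a b c κ ν w : ℚ) →
  c ℚ.+ ℕ→ℚ 2 ℚ.* κ ℚ.* b ≡ (ℕ→ℚ 3 ℚ.+ ℕ→ℚ 2 ℚ.* κ) ℚ.* a ℚ.+ ν ℚ.* b →
  (a ℚ.* w ℚ.- ℕ→ℚ 2 ℚ.* (κ ℚ.* (b ℚ.* w) ℚ.- (1ℚ ℚ.+ κ) ℚ.* (a ℚ.* w))) ℚ.+ (ν ℚ.* (b ℚ.* w) ℚ.- c ℚ.* w)
    ≡ 0ℚ
𝓛-suc-vanishes a b c κ ν w recurrence = begin
  (a ℚ.* w ℚ.- ℕ→ℚ 2 ℚ.* (κ ℚ.* (b ℚ.* w) ℚ.- (1ℚ ℚ.+ κ) ℚ.* (a ℚ.* w))) ℚ.+ (ν ℚ.* (b ℚ.* w) ℚ.- c ℚ.* w)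
    ≡⟨ solve 6 (λ a b c κ ν w →
         (a :* w :- con (ℕ→ℚ 2) :* (κ :* (b :* w) :- (con 1ℚ :+ κ) :* (a :* w))) :+ (ν :* (b :* w) :- c :* w)
         := (rhs a b ν κ :- lhs b c κ) :* w)
         refl a b c κ ν w ⟩
  ((ℕ→ℚ 3 ℚ.+ ℕ→ℚ 2 ℚ.* κ) ℚ.* a ℚ.+ ν ℚ.* b ℚ.- (c ℚ.+ ℕ→ℚ 2 ℚ.* κ ℚ.* b)) ℚ.* w
    ≡⟨ cong (λ z → (z ℚ.- (c ℚ.+ ℕ→ℚ 2 ℚ.* κ ℚ.* b)) ℚ.* w) (sym recurrence) ⟩
  (c ℚ.+ ℕ→ℚ 2 ℚ.* κ ℚ.* b ℚ.- (c ℚ.+ ℕ→ℚ 2 ℚ.* κ ℚ.* b)) ℚ.* w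
    ≡⟨ solve 2 (λ x w → (x :- x) :* w := con 0ℚ) refl (c ℚ.+ ℕ→ℚ 2 ℚ.* κ ℚ.* b) w ⟩
  0ℚ ∎
  where
  open ≡-Reasoning
  lhs = λ b c κ → c :+ con (ℕ→ℚ 2) :* κ :* b
  rhs = λ a b ν κ → (con (ℕ→ℚ 3) :+ con (ℕ→ℚ 2) :* κ) :* a :+ ν :* b

𝓛-zero-vanishes : ∀ (a : ℚ) → (a ℚ.- ℕ→ℚ 2 ℚ.* (0ℚ ℚ.- 0ℚ)) ℚ.+ (0ℚ ℚ.- a) ≡ 0ℚ
𝓛-zero-vanishes = solve 1 (λ a → (a :- con (ℕ→ℚ 2) :* (con 0ℚ :- con 0ℚ)) :+ (con 0ℚ :- a) := con 0ℚ) refl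

𝓛𝓡-zero : ∀ n → let a = ℕ→ℚ (R n 0) ℚ.* 1/ n ! in
           𝓛 𝓡 n 0 ≡ (a ℚ.- ℕ→ℚ 2 ℚ.* (0ℚ ℚ.- 0ℚ)) ℚ.+ (0ℚ ℚ.- a)
𝓛𝓡-zero n = trans (𝓛-zero 𝓡 n) (cong₂ (λ p q → (p ℚ.- ℕ→ℚ 2 ℚ.* (0ℚ ℚ.- 0ℚ)) ℚ.+ (0ℚ ℚ.- q))
  (𝓡≡R·1/n! n 0) (trans (∂x𝓡≡R·1/n! n 0) (cong (λ r → ℕ→ℚ r ℚ.* 1/ n !) (R-suc-zero n))))

𝓛𝓡-suc : ∀ n k →
  let a = ℕ→ℚ (R n (suc k)); b = ℕ→ℚ (R n k)
      c = ℕ→ℚ (R (suc n) (suc k)); w = 1/ n !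
  in 𝓛 𝓡 n (suc k) ≡ (a ℚ.* w ℚ.- ℕ→ℚ 2 ℚ.* (ℕ→ℚ k ℚ.* (b ℚ.* w) ℚ.- (1ℚ ℚ.+ ℕ→ℚ k) ℚ.* (a ℚ.* w)))
                       ℚ.+ (ℕ→ℚ n ℚ.* (b ℚ.* w) ℚ.- c ℚ.* w)
𝓛𝓡-suc n k = trans (𝓛-suc 𝓡 n k)
  (cong₄ (λ A B C S → (A ℚ.- ℕ→ℚ 2 ℚ.* (ℕ→ℚ k ℚ.* B ℚ.- S ℚ.* A)) ℚ.+ (ℕ→ℚ n ℚ.* B ℚ.- C))
         (𝓡≡R·1/n! n (suc k)) (𝓡≡R·1/n! n k) (∂x𝓡≡R·1/n! n (suc k)) (ℕ→ℚ-+ 1 k))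
  where
  cong₄ : ∀ (f : ℚ → ℚ → ℚ → ℚ → ℚ) {x x′ y y′ z z′ u u′} →
          x ≡ x′ → y ≡ y′ → z ≡ z′ → u ≡ u′ → f x y z u ≡ f x′ y′ z′ u′
  cong₄ f refl refl refl refl = refl

theorem3p3 : ∀ (n k : ℕ) →
    ((𝓡 ⊖ (ℕ→ℚ 2 · (mulY (mulY (∂y 𝓡)) ⊖ mulY (∂y 𝓡))))
      ⊕ (mulX (mulY (∂x 𝓡)) ⊖ ∂x 𝓡)) n k ≡ 𝟘 n k
theorem3p3 n zero    = trans (𝓛𝓡-zero n) (𝓛-zero-vanishes (ℕ→ℚ (R n 0) ℚ.* 1/ n !))
theorem3p3 n (suc k) = trans (𝓛𝓡-suc n k)
  (𝓛-suc-vanishes (ℕ→ℚ (R n (suc k))) (ℕ→ℚ (R n k)) (ℕ→ℚ (R (suc n) (suc k))) (ℕ→ℚ k) (ℕ→ℚ n) (1/ n !)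
                  (R-suc-suc-ℚ n k))
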